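{- The category $\mathbf{IStr}$ is equivalent to the full subcategory of $\mathcal{R}$ consisting of simple incidence hypergraphs, and this subcategory is reflective in $\mathcal{R}$. Moreover, $\mathbf{IStr}$ is complete and cocomplete, and its limits and colimits are obtained by passing to $\mathcal{R}$ and then applying the simplification: for a small diagram $D$ in $\mathbf{IStr}$, a limit (resp. colimit) of $D$ is $\mathcal{S}_{\mathcal{R}}$ applied to a limit (resp. colimit) of $\mathcal{N}_{\mathcal{R}}\circ D$ in $\mathcal{R}$.
   Context: $\mathcal{R}$ is the category of incidence hypergraphs: objects are $G=(V(G),E(G),I(G),\varsigma_G,\omega_G)$ with sets $V(G)$ (vertices), $E(G)$ (edges), $I(G)$ (incidences) and functions $\varsigma_G:I(G)\to V(G)$, $\omega_G:I(G)\to E(G)$; a morphism $G\to G'$ is a triple of functions $(V(\phi),E(\phi),I(\phi))$ with $\varsigma_{G'}\circ I(\phi)=V(\phi)\circ\varsigma_G$ and $\omega_{G'}\circ I(\phi)=E(\phi)\circ\omega_G$. $G$ is simple if $i\mapsto(\varsigma_G(i),\omega_G(i))$, $I(G)\to V(G)\times E(G)$, is injective. $\mathbf{IStr}$ is the category of incidence structures: objects are triples $(V,E,\alpha)$ with sets $V,E$ and $\alpha\subseteq V\times E$; morphisms $(V,E,\alpha)\to(V',E',\alpha')$ are pairs of functions $f:V\to V'$, $g:E\to E'$ with $(f(v),g(e))\in\alpha'$ whenever $(v,e)\in\alpha$. The functor $\mathcal{N}_{\mathcal{R}}:\mathbf{IStr}\to\mathcal{R}$ sends $(V,E,\alpha)$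 to $(V,E,\alpha,\pi_V|_\alpha,\pi_E|_\alpha)$ and $(f,g)$ to $(f,g,(f\times g)|_\alpha)$. The simplification functor $\mathcal{S}_{\mathcal{R}}:\mathcal{R}\to\mathbf{IStr}$ sends $G$ to $(V(G),E(G),\{(\varsigma_G(i),\omega_G(i)):i\in I(G)\})$ and $\phi$ to $(V(\phi),E(\phi))$. -}

module Defs where

open import Level using (Level; _⊔_; 0ℓ) renaming (suc to lsuc)
open import Data.Product using (Σ; Σ-syntax; _×_; _,_; proj₁; proj₂)
open import Relation.Binary.Core using (Rel)
open import Relation.Binary.Structures using (IsEquivalence)
open import Relation.Binary.Bundles using (Setoid)
open import Function.Bundles using (Func)

-- Sets are modelled as setoids; equality of morphisms is a setoid
-- equality (for the concrete categories below: pointwise equality).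

record Category (o m e : Level) : Set (lsuc (o ⊔ m ⊔ e)) where
  infixr 9 _∘_
  infix  4 _≈_
  field
    Obj       : Set o
    _⇒_       : Obj → Obj → Set m
    _≈_       : ∀ {A B} → Rel (A ⇒ B) e
    equiv     : ∀ {A B} → IsEquivalence (_≈_ {A} {B})
    id        : ∀ {A} → A ⇒ A
    _∘_       : ∀ {A B C} → B ⇒ C → A ⇒ B → A ⇒ C
    assoc     : ∀ {A B C D} {f : A ⇒ B} {g : B ⇒ C} {h : C ⇒ D} →
                (h ∘ g) ∘ f ≈ h ∘ (g ∘ f)
    identityˡ : ∀ {A B} {f : A ⇒ B} → id ∘ f ≈ f
    identityʳ : ∀ {A B} {f : A ⇒ B} → f ∘ id ≈ f
    ∘-resp-≈  : ∀ {A B C} {f h : B ⇒ C} {g i : A ⇒ B} →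
                f ≈ h → g ≈ i → f ∘ g ≈ h ∘ i

record Functor {o m e o′ m′ e′ : Level}
               (C : Category o m e) (D : Category o′ m′ e′)
               : Set (o ⊔ m ⊔ e ⊔ o′ ⊔ m′ ⊔ e′) where
  private
    module C = Category C
    module D = Category D
  field
    F₀           : C.Obj → D.Obj
    F₁           : ∀ {A B} → A C.⇒ B → F₀ A D.⇒ F₀ B
    identity     : ∀ {A} → F₁ (C.id {A}) D.≈ D.id
    homomorphism : ∀ {A B C′} {f : A C.⇒ B} {g : B C.⇒ C′} →
                   F₁ (g C.∘ f) D.≈ F₁ g D.∘ F₁ f
    F-resp-≈     : ∀ {A B} {f g : A C.⇒ B} → f C.≈ g → F₁ f D.≈ F₁ g

open Functor public

infixr 9 _∘F_
_∘F_ : ∀ {o m e o′ m′ e′ o″ m″ e″}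
         {C : Category o m e} {D : Category o′ m′ e′} {E : Category o″ m″ e″} →
       Functor D E → Functor C D → Functor C E
_∘F_ {E = E} G F = record
  { F₀ = λ A → F₀ G (F₀ F A)
  ; F₁ = λ f → F₁ G (F₁ F f)
  ; identity = trans (F-resp-≈ G (identity F)) (identity G)
  ; homomorphism = trans (F-resp-≈ G (homomorphism F)) (homomorphism G)
  ; F-resp-≈ = λ p → F-resp-≈ G (F-resp-≈ F p)
  }
  where open module E = Category E using (equiv)
        open module Eq {A} {B} = IsEquivalence (equiv {A} {B}) using (trans)

idF : ∀ {o m e} {C : Category o m e} → Functor C C
idF {C = C} = record
  { F₀ = λ A → A ; F₁ = λ f → f
  ; identity = refl ; homomorphism = refl ; F-resp-≈ = λ p → p }
  where open Category C using (equiv)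
        open module Eq {A} {B} = IsEquivalence (equiv {A} {B}) using (refl)

module _ {o m e o′ m′ e′ : Level}
         {C : Category o m e} {D : Category o′ m′ e′} where
  private
    module C = Category C
    module D = Category D

  record NaturalIsomorphism (F G : Functor C D) : Set (o ⊔ m ⊔ m′ ⊔ e′) where
    field
      η        : ∀ A → F₀ F A D.⇒ F₀ G A
      η⁻¹      : ∀ A → F₀ G A D.⇒ F₀ F A
      natural  : ∀ {A B} (f : A C.⇒ B) → η B D.∘ F₁ F f D.≈ F₁ G f D.∘ η A
      isoˡ     : ∀ A → η⁻¹ A D.∘ η A D.≈ D.id
      isoʳ     : ∀ A → η A D.∘ η⁻¹ A D.≈ D.id

record Equivalence {o m e o′ m′ e′ : Level}
                   (C : Category o m e) (D : Category o′ m′ e′)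
                   : Set (o ⊔ m ⊔ e ⊔ o′ ⊔ m′ ⊔ e′) where
  field
    F    : Functor C D
    G    : Functor D C
    unit : NaturalIsomorphism (idF {C = C}) (G ∘F F)
    counit : NaturalIsomorphism (F ∘F G) (idF {C = D})

FullSubcategory : ∀ {o m e p} (C : Category o m e) →
                  (Category.Obj C → Set p) → Category (o ⊔ p) m e
FullSubcategory C P = record
  { Obj = Σ Obj P
  ; _⇒_ = λ A B → proj₁ A ⇒ proj₁ B
  ; _≈_ = _≈_
  ; equiv = equiv
  ; id = id
  ; _∘_ = _∘_
  ; assoc = assoc
  ; identityˡ = identityˡ
  ; identityʳ = identityʳ
  ; ∘-resp-≈ = ∘-resp-≈
  }
  where open Category C

Reflective : ∀ {o m e p} (C : Category o m e) → (Category.Obj C → Set p) →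
             Set (o ⊔ m ⊔ e ⊔ p)
Reflective C P =
  ∀ (A : Obj) → Σ[ R ∈ Obj ] Σ[ _ ∈ P R ] Σ[ η ∈ A ⇒ R ]
    (∀ (B : Obj) → P B → (f : A ⇒ B) →
       Σ[ g ∈ R ⇒ B ] ((g ∘ η ≈ f) × (∀ (g′ : R ⇒ B) → g′ ∘ η ≈ f → g′ ≈ g)))
  where open Category C

module _ {o m e o′ m′ e′ : Level}
         {J : Category o m e} {C : Category o′ m′ e′} (D : Functor J C) where
  private
    module J = Category J
    module C = Category C

  record Cone : Set (o ⊔ m ⊔ o′ ⊔ m′ ⊔ e′) where
    field
      apex    : C.Obj
      ψ       : ∀ j → apex C.⇒ F₀ D j
      commute : ∀ {i j} (f : i J.⇒ j) → F₁ D f C.∘ ψ i C.≈ ψ j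

  record Cocone : Set (o ⊔ m ⊔ o′ ⊔ m′ ⊔ e′) where
    field
      coapex  : C.Obj
      ψ       : ∀ j → F₀ D j C.⇒ coapex
      commute : ∀ {i j} (f : i J.⇒ j) → ψ j C.∘ F₁ D f C.≈ ψ i

  IsLimit : Cone → Set (o ⊔ m ⊔ o′ ⊔ m′ ⊔ e′)
  IsLimit L = ∀ (K : Cone) →
    Σ[ u ∈ Cone.apex K C.⇒ Cone.apex L ]
      ((∀ j → Cone.ψ L j C.∘ u C.≈ Cone.ψ K j) ×
       (∀ (u′ : Cone.apex K C.⇒ Cone.apex L) →
          (∀ j → Cone.ψ L j C.∘ u′ C.≈ Cone.ψ K j) → u′ C.≈ u))

  IsColimit : Cocone → Set (o ⊔ m ⊔ o′ ⊔ m′ ⊔ e′)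
  IsColimit L = ∀ (K : Cocone) →
    Σ[ u ∈ Cocone.coapex L C.⇒ Cocone.coapex K ]
      ((∀ j → u C.∘ Cocone.ψ L j C.≈ Cocone.ψ K j) ×
       (∀ (u′ : Cocone.coapex L C.⇒ Cocone.coapex K) →
          (∀ j → u′ C.∘ Cocone.ψ L j C.≈ Cocone.ψ K j) → u′ C.≈ u))

  Limit : Set (o ⊔ m ⊔ o′ ⊔ m′ ⊔ e′)
  Limit = Σ Cone IsLimit

  Colimit : Set (o ⊔ m ⊔ o′ ⊔ m′ ⊔ e′)
  Colimit = Σ Cocone IsColimit

-- Small diagrams are indexed by categories at level 0.
Complete : ∀ {o m e} → Category o m e → Set (lsuc 0ℓ ⊔ o ⊔ m ⊔ e)
Complete C = ∀ (J : Category 0ℓ 0ℓ 0ℓ) (D : Functor J C) → Limit D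

Cocomplete : ∀ {o m e} → Category o m e → Set (lsuc 0ℓ ⊔ o ⊔ m ⊔ e)
Cocomplete C = ∀ (J : Category 0ℓ 0ℓ 0ℓ) (D : Functor J C) → Colimit D

record Hyp : Set₁ where
  field
    V E I : Setoid 0ℓ 0ℓ
    ς     : Func I V
    ω     : Func I E

record HypHom (G H : Hyp) : Set where
  private
    module G = Hyp G
    module H = Hyp H
    module VH = Setoid H.V
    module EH = Setoid H.E
  field
    fV : Func G.V H.V
    fE : Func G.E H.E
    fI : Func G.I H.I
    ς-comm : ∀ i → Func.to H.ς (Func.to fI i) VH.≈ Func.to fV (Func.to G.ς i)
    ω-comm : ∀ i → Func.to H.ω (Func.to fI i) EH.≈ Func.to fE (Func.to G.ω i)

record HypHom≈ {G H : Hyp} (φ ψ : HypHom G H) : Set where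
  private
    module G = Hyp G
    module H = Hyp H
  field
    ≈V : ∀ v → Setoid._≈_ H.V (Func.to (HypHom.fV φ) v) (Func.to (HypHom.fV ψ) v)
    ≈E : ∀ e → Setoid._≈_ H.E (Func.to (HypHom.fE φ) e) (Func.to (HypHom.fE ψ) e)
    ≈I : ∀ i → Setoid._≈_ H.I (Func.to (HypHom.fI φ) i) (Func.to (HypHom.fI ψ) i)

module _ where
  private
    idFunc : ∀ (A : Setoid 0ℓ 0ℓ) → Func A A
    idFunc A = record { to = λ x → x ; cong = λ p → p }

    _∘S_ : ∀ {A B C : Setoid 0ℓ 0ℓ} → Func B C → Func A B → Func A C
    g ∘S f = record { to = λ x → Func.to g (Func.to f x)
                    ; cong = λ p → Func.cong g (Func.cong f p) }

  open Setoid using (refl; sym; trans)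

  ℛ : Category (lsuc 0ℓ) 0ℓ 0ℓ
  ℛ = record
    { Obj = Hyp
    ; _⇒_ = HypHom
    ; _≈_ = HypHom≈
    ; equiv = λ {G} {H} → record
        { refl = record { ≈V = λ _ → refl (Hyp.V H) ; ≈E = λ _ → refl (Hyp.E H)
                        ; ≈I = λ _ → refl (Hyp.I H) }
        ; sym = λ p → record { ≈V = λ v → sym (Hyp.V H) (HypHom≈.≈V p v)
                             ; ≈E = λ e → sym (Hyp.E H) (HypHom≈.≈E p e)
                             ; ≈I = λ i → sym (Hyp.I H) (HypHom≈.≈I p i) }
        ; trans = λ p q → record
            { ≈V = λ v → trans (Hyp.V H) (HypHom≈.≈V p v) (HypHom≈.≈V q v)
            ; ≈E = λ e → trans (Hyp.E H) (HypHom≈.≈E p e) (HypHom≈.≈E q e)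
            ; ≈I = λ i → trans (Hyp.I H) (HypHom≈.≈I p i) (HypHom≈.≈I q i) } }
    ; id = λ {G} → record
        { fV = idFunc (Hyp.V G) ; fE = idFunc (Hyp.E G) ; fI = idFunc (Hyp.I G)
        ; ς-comm = λ _ → refl (Hyp.V G) ; ω-comm = λ _ → refl (Hyp.E G) }
    ; _∘_ = λ {A} {B} {C} ψ φ → record
        { fV = HypHom.fV ψ ∘S HypHom.fV φ
        ; fE = HypHom.fE ψ ∘S HypHom.fE φ
        ; fI = HypHom.fI ψ ∘S HypHom.fI φ
        ; ς-comm = λ i → trans (Hyp.V C) (HypHom.ς-comm ψ _)
                           (Func.cong (HypHom.fV ψ) (HypHom.ς-comm φ i))
        ; ω-comm = λ i → trans (Hyp.E C) (HypHom.ω-comm ψ _)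
                           (Func.cong (HypHom.fE ψ) (HypHom.ω-comm φ i)) }
    ; assoc = λ {D = D} → record { ≈V = λ _ → refl (Hyp.V D) ; ≈E = λ _ → refl (Hyp.E D)
                                 ; ≈I = λ _ → refl (Hyp.I D) }
    ; identityˡ = λ {B = B} → record { ≈V = λ _ → refl (Hyp.V B) ; ≈E = λ _ → refl (Hyp.E B)
                                     ; ≈I = λ _ → refl (Hyp.I B) }
    ; identityʳ = λ {B = B} → record { ≈V = λ _ → refl (Hyp.V B) ; ≈E = λ _ → refl (Hyp.E B)
                                     ; ≈I = λ _ → refl (Hyp.I B) }
    ; ∘-resp-≈ = λ {C = C} {f} {h} p q → record
        { ≈V = λ v → trans (Hyp.V C) (HypHom≈.≈V p _) (Func.cong (HypHom.fV h) (HypHom≈.≈V q v))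
        ; ≈E = λ e → trans (Hyp.E C) (HypHom≈.≈E p _) (Func.cong (HypHom.fE h) (HypHom≈.≈E q e))
        ; ≈I = λ i → trans (Hyp.I C) (HypHom≈.≈I p _) (Func.cong (HypHom.fI h) (HypHom≈.≈I q i)) }
    }

Simple : Hyp → Set
Simple G = ∀ i j → Setoid._≈_ V (Func.to ς i) (Func.to ς j) →
                   Setoid._≈_ E (Func.to ω i) (Func.to ω j) → Setoid._≈_ I i j
  where open Hyp G

ℛsimple : Category (lsuc 0ℓ) 0ℓ 0ℓ
ℛsimple = FullSubcategory ℛ Simple

-- α ⊆ V × E, a subset of the (setoid) product, i.e. closed under ≈.
record IS : Set₁ where
  field
    V E   : Setoid 0ℓ 0ℓ
    α     : Setoid.Carrier V → Setoid.Carrier E → Set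
    α-resp : ∀ {v v′ e e′} → Setoid._≈_ V v v′ → Setoid._≈_ E e e′ → α v e → α v′ e′

record ISHom (X Y : IS) : Set where
  private
    module X = IS X
    module Y = IS Y
  field
    f   : Func X.V Y.V
    g   : Func X.E Y.E
    pres : ∀ {v e} → X.α v e → Y.α (Func.to f v) (Func.to g e)

record ISHom≈ {X Y : IS} (φ ψ : ISHom X Y) : Set where
  field
    ≈f : ∀ v → Setoid._≈_ (IS.V Y) (Func.to (ISHom.f φ) v) (Func.to (ISHom.f ψ) v)
    ≈g : ∀ e → Setoid._≈_ (IS.E Y) (Func.to (ISHom.g φ) e) (Func.to (ISHom.g ψ) e)

module _ where
  open Setoid using (refl; sym; trans)

  IStr : Category (lsuc 0ℓ) 0ℓ 0ℓ
  IStr = record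
    { Obj = IS
    ; _⇒_ = ISHom
    ; _≈_ = ISHom≈
    ; equiv = λ {X} {Y} → record
        { refl = record { ≈f = λ _ → refl (IS.V Y) ; ≈g = λ _ → refl (IS.E Y) }
        ; sym = λ p → record { ≈f = λ v → sym (IS.V Y) (ISHom≈.≈f p v)
                             ; ≈g = λ e → sym (IS.E Y) (ISHom≈.≈g p e) }
        ; trans = λ p q → record
            { ≈f = λ v → trans (IS.V Y) (ISHom≈.≈f p v) (ISHom≈.≈f q v)
            ; ≈g = λ e → trans (IS.E Y) (ISHom≈.≈g p e) (ISHom≈.≈g q e) } }
    ; id = λ {X} → record
        { f = record { to = λ x → x ; cong = λ p → p }
        ; g = record { to = λ x → x ; cong = λ p → p }
        ; pres = λ a → a }
    ; _∘_ = λ ψ φ → record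
        { f = record { to = λ x → Func.to (ISHom.f ψ) (Func.to (ISHom.f φ) x)
                     ; cong = λ p → Func.cong (ISHom.f ψ) (Func.cong (ISHom.f φ) p) }
        ; g = record { to = λ x → Func.to (ISHom.g ψ) (Func.to (ISHom.g φ) x)
                     ; cong = λ p → Func.cong (ISHom.g ψ) (Func.cong (ISHom.g φ) p) }
        ; pres = λ a → ISHom.pres ψ (ISHom.pres φ a) }
    ; assoc = λ {D = D} → record { ≈f = λ _ → refl (IS.V D) ; ≈g = λ _ → refl (IS.E D) }
    ; identityˡ = λ {B = B} → record { ≈f = λ _ → refl (IS.V B) ; ≈g = λ _ → refl (IS.E B) }
    ; identityʳ = λ {B = B} → record { ≈f = λ _ → refl (IS.V B) ; ≈g = λ _ → refl (IS.E B) }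
    ; ∘-resp-≈ = λ {C = C} {f} {h} p q → record
        { ≈f = λ v → trans (IS.V C) (ISHom≈.≈f p _) (Func.cong (ISHom.f h) (ISHom≈.≈f q v))
        ; ≈g = λ e → trans (IS.E C) (ISHom≈.≈g p _) (Func.cong (ISHom.g h) (ISHom≈.≈g q e)) }
    }

-- The incidence setoid of 𝒩ℛ(V,E,α): the elements of α ⊆ V × E, with the
-- equality of V × E (the witness of membership is irrelevant).
αSetoid : IS → Setoid 0ℓ 0ℓ
αSetoid X = record
  { Carrier = Σ[ v ∈ Setoid.Carrier V ] Σ[ e ∈ Setoid.Carrier E ] α v e
  ; _≈_ = λ p q → Setoid._≈_ V (proj₁ p) (proj₁ q) × Setoid._≈_ E (proj₁ (proj₂ p)) (proj₁ (proj₂ q))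
  ; isEquivalence = record
      { refl = Setoid.refl V , Setoid.refl E
      ; sym = λ (a , b) → Setoid.sym V a , Setoid.sym E b
      ; trans = λ (a , b) (c , d) → Setoid.trans V a c , Setoid.trans E b d } }
  where open IS X

𝒩₀ : IS → Hyp
𝒩₀ X = record
  { V = IS.V X ; E = IS.E X ; I = αSetoid X
  ; ς = record { to = proj₁ ; cong = proj₁ }
  ; ω = record { to = λ p → proj₁ (proj₂ p) ; cong = proj₂ } }

𝒩₁ : ∀ {X Y} → ISHom X Y → HypHom (𝒩₀ X) (𝒩₀ Y)
𝒩₁ {X} {Y} φ = record
  { fV = ISHom.f φ ; fE = ISHom.g φ
  ; fI = record
      { to = λ (v , e , a) → Func.to (ISHom.f φ) v , Func.to (ISHom.g φ) e , ISHom.pres φ a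
      ; cong = λ (p , q) → Func.cong (ISHom.f φ) p , Func.cong (ISHom.g φ) q }
  ; ς-comm = λ _ → Setoid.refl (IS.V Y)
  ; ω-comm = λ _ → Setoid.refl (IS.E Y) }

𝒩ℛ : Functor IStr ℛ
𝒩ℛ = record
  { F₀ = 𝒩₀
  ; F₁ = 𝒩₁
  ; identity = λ {X} → record { ≈V = λ _ → Setoid.refl (IS.V X) ; ≈E = λ _ → Setoid.refl (IS.E X)
                              ; ≈I = λ _ → Setoid.refl (IS.V X) , Setoid.refl (IS.E X) }
  ; homomorphism = λ {C′ = Z} → record
      { ≈V = λ _ → Setoid.refl (IS.V Z) ; ≈E = λ _ → Setoid.refl (IS.E Z)
      ; ≈I = λ _ → Setoid.refl (IS.V Z) , Setoid.refl (IS.E Z) }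
  ; F-resp-≈ = λ p → record { ≈V = ISHom≈.≈f p ; ≈E = ISHom≈.≈g p
                            ; ≈I = λ (v , e , _) → ISHom≈.≈f p v , ISHom≈.≈g p e }
  }

𝒮₀ : Hyp → IS
𝒮₀ G = record
  { V = V ; E = E
  ; α = λ v e → Σ[ i ∈ Setoid.Carrier I ]
                  (Setoid._≈_ V (Func.to ς i) v × Setoid._≈_ E (Func.to ω i) e)
  ; α-resp = λ p q (i , a , b) → i , Setoid.trans V a p , Setoid.trans E b q }
  where open Hyp G

𝒮₁ : ∀ {G H} → HypHom G H → ISHom (𝒮₀ G) (𝒮₀ H)
𝒮₁ {G} {H} φ = record
  { f = HypHom.fV φ ; g = HypHom.fE φ
  ; pres = λ (i , a , b) →
      Func.to (HypHom.fI φ) i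
      , Setoid.trans (Hyp.V H) (HypHom.ς-comm φ i) (Func.cong (HypHom.fV φ) a)
      , Setoid.trans (Hyp.E H) (HypHom.ω-comm φ i) (Func.cong (HypHom.fE φ) b) }

𝒮ℛ : Functor ℛ IStr
𝒮ℛ = record
  { F₀ = 𝒮₀
  ; F₁ = 𝒮₁
  ; identity = λ {G} → record { ≈f = λ _ → Setoid.refl (Hyp.V G) ; ≈g = λ _ → Setoid.refl (Hyp.E G) }
  ; homomorphism = λ {C′ = K} → record { ≈f = λ _ → Setoid.refl (Hyp.V K)
                                       ; ≈g = λ _ → Setoid.refl (Hyp.E K) }
  ; F-resp-≈ = λ p → record { ≈f = HypHom≈.≈V p ; ≈g = HypHom≈.≈E p }
  }

-- The canonical identifications 𝒮ℛ(𝒩ℛ X) ≅ X, which are the identity on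
-- vertices and edges (in the paper, 𝒮ℛ ∘ 𝒩ℛ is literally the identity).
ε : ∀ X → ISHom (𝒮₀ (𝒩₀ X)) X
ε X = record
  { f = record { to = λ x → x ; cong = λ p → p }
  ; g = record { to = λ x → x ; cong = λ p → p }
  ; pres = λ ((v , e , a) , p , q) → IS.α-resp X p q a }

ε⁻¹ : ∀ X → ISHom X (𝒮₀ (𝒩₀ X))
ε⁻¹ X = record
  { f = record { to = λ x → x ; cong = λ p → p }
  ; g = record { to = λ x → x ; cong = λ p → p }
  ; pres = λ {v} {e} a → (v , e , a) , Setoid.refl (IS.V X) , Setoid.refl (IS.E X) }

-- Apply 𝒮ℛ to a cone (resp. cocone) over 𝒩ℛ ∘ D and identify 𝒮ℛ 𝒩ℛ with
-- the identity, obtaining a cone (resp. cocone) over D in IStr.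
module _ {J : Category 0ℓ 0ℓ 0ℓ} (D : Functor J IStr) where

  𝒮-cone : Cone (𝒩ℛ ∘F D) → Cone D
  𝒮-cone L = record
    { apex = 𝒮₀ (Cone.apex L)
    ; ψ = λ j → Category._∘_ IStr (ε (F₀ D j)) (𝒮₁ (Cone.ψ L j))
    ; commute = λ f → record { ≈f = HypHom≈.≈V (Cone.commute L f)
                             ; ≈g = HypHom≈.≈E (Cone.commute L f) }
    }

  𝒮-cocone : Cocone (𝒩ℛ ∘F D) → Cocone D
  𝒮-cocone L = record
    { coapex = 𝒮₀ (Cocone.coapex L)
    ; ψ = λ j → Category._∘_ IStr (𝒮₁ (Cocone.ψ L j)) (ε⁻¹ (F₀ D j))
    ; commute = λ f → record { ≈f = HypHom≈.≈V (Cocone.commute L f)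
                             ; ≈g = HypHom≈.≈E (Cocone.commute L f) }
    }

-- 𝒮ℛ is left adjoint to 𝒩ℛ, and 𝒩ℛ is fully faithful with image the simple
-- hypergraphs, because a homomorphism into a simple hypergraph is determined
-- by its vertex and edge maps: each incidence has to go to the unique incidence
-- over the image of its (vertex, edge) pair. This gives the equivalence and the
-- reflection G → 𝒩ℛ(𝒮ℛ G). Limits in IStr are compatible families of vertices
-- and edges, incident when incident in every component; colimits glue the
-- vertices and edges along the diagram and keep the images of incidences.
-- A limit in ℛ of simple hypergraphs is simple (two incidences over the same
-- pair have the same projections), so maps into it are again determined on
-- vertices and edges and the universal property descends along 𝒮ℛ; colimits
-- descend along the adjunction 𝒮ℛ ⊣ 𝒩ℛ.
module Submission where

open import Defs
open import Level using (0ℓ)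
open import Data.Product using (Σ; Σ-syntax; _×_; _,_; proj₁; proj₂)
open import Data.Unit using (tt)
open import Data.Unit.Properties using (≡-setoid)
open import Function.Bundles using (Func; _⟨$⟩_)
import Function.Construct.Constant as Constant
import Function.Construct.Identity as Identity
open import Relation.Binary.Bundles using (Setoid)
open import Relation.Binary.Core using (Rel)
open import Relation.Binary.Structures using (IsEquivalence)
import Relation.Binary.Construct.Closure.Equivalence as EqClosure

open Setoid using (refl; sym; trans)

module _ {o m e o′ m′ e′} {J : Category o m e} {C : Category o′ m′ e′} {D : Functor J C} where
  open Category C
  private module ≈ {A B} = IsEquivalence (equiv {A} {B})

  limit-arrows-unique : (L : Cone D) → IsLimit D L → ∀ {X} (u v : X ⇒ Cone.apex L) →
                        (∀ j → Cone.ψ L j ∘ u ≈ Cone.ψ L j ∘ v) → u ≈ v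
  limit-arrows-unique L isLimit {X} u v ψu≈ψv =
    ≈.trans (unique u (λ _ → ≈.refl)) (≈.sym (unique v (λ j → ≈.sym (ψu≈ψv j))))
    where
      cone-through-u : Cone D
      cone-through-u = record
        { apex = X
        ; ψ = λ j → Cone.ψ L j ∘ u
        ; commute = λ f → ≈.trans (≈.sym assoc) (∘-resp-≈ (Cone.commute L f) ≈.refl)
        }
      unique : ∀ (w : X ⇒ Cone.apex L) → (∀ j → Cone.ψ L j ∘ w ≈ Cone.ψ L j ∘ u) →
               w ≈ proj₁ (isLimit cone-through-u)
      unique = proj₂ (proj₂ (isLimit cone-through-u))

module _ {o m e o′ m′ e′ p} {C : Category o m e} {D : Category o′ m′ e′}
         {P : Category.Obj D → Set p} where

  corestrict : (F : Functor C D) → (∀ A → P (F₀ F A)) → Functor C (FullSubcategory D P)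
  corestrict F inP = record
    { F₀ = λ A → F₀ F A , inP A
    ; F₁ = F₁ F
    ; identity = identity F
    ; homomorphism = homomorphism F
    ; F-resp-≈ = F-resp-≈ F
    }

  restrict : Functor D C → Functor (FullSubcategory D P) C
  restrict G = record
    { F₀ = λ A → F₀ G (proj₁ A)
    ; F₁ = F₁ G
    ; identity = identity G
    ; homomorphism = homomorphism G
    ; F-resp-≈ = F-resp-≈ G
    }

ISHom≈-pres-irrelevant : ∀ {X Y} {φ : ISHom X Y}
  {pres : ∀ {v e} → IS.α X v e → IS.α Y (ISHom.f φ ⟨$⟩ v) (ISHom.g φ ⟨$⟩ e)} →
  ISHom≈ φ (record { f = ISHom.f φ ; g = ISHom.g φ ; pres = pres })
ISHom≈-pres-irrelevant {Y = Y} = record { ≈f = λ _ → refl (IS.V Y) ; ≈g = λ _ → refl (IS.E Y) }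

𝒩-simple : ∀ X → Simple (𝒩₀ X)
𝒩-simple X i j ς≈ ω≈ = ς≈ , ω≈

𝒮-faithful : ∀ {G H} {φ ψ : HypHom G H} → Simple H → ISHom≈ (𝒮₁ φ) (𝒮₁ ψ) → HypHom≈ φ ψ
𝒮-faithful {H = H} {φ} {ψ} simple φ≈ψ = record
  { ≈V = ≈f
  ; ≈E = ≈g
  ; ≈I = λ i → simple _ _
      (trans V (ς-comm φ i) (trans V (≈f _) (sym V (ς-comm ψ i))))
      (trans E (ω-comm φ i) (trans E (≈g _) (sym E (ω-comm ψ i))))
  }
  where
    open Hyp H using (V; E)
    open HypHom using (ς-comm; ω-comm)
    open ISHom≈ φ≈ψ

𝒩-transpose : ∀ {G X} → ISHom (𝒮₀ G) X → HypHom G (𝒩₀ X)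
𝒩-transpose {G} {X} φ = record
  { fV = f
  ; fE = g
  ; fI = record
      { to = λ i → f ⟨$⟩ (ς ⟨$⟩ i) , g ⟨$⟩ (ω ⟨$⟩ i) , pres (i , refl V , refl E)
      ; cong = λ i≈j → Func.cong f (Func.cong ς i≈j) , Func.cong g (Func.cong ω i≈j)
      }
  ; ς-comm = λ _ → refl (IS.V X)
  ; ω-comm = λ _ → refl (IS.E X)
  }
  where
    open Hyp G
    open ISHom φ

simple-transpose : ∀ {X H} → Simple H → ISHom X (𝒮₀ H) → HypHom (𝒩₀ X) H
simple-transpose {X} {H} simple φ = record
  { fV = f
  ; fE = g
  ; fI = record
      { to = λ x → proj₁ (over x)
      ; cong = λ {x} {y} (v≈ , e≈) → simple _ _
          (trans V (ς-over x) (trans V (Func.cong f v≈) (sym V (ς-over y))))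
          (trans E (ω-over x) (trans E (Func.cong g e≈) (sym E (ω-over y))))
      }
  ; ς-comm = ς-over
  ; ω-comm = ω-over
  }
  where
    open Hyp H
    open ISHom φ

    over : (x : Setoid.Carrier (αSetoid X)) →
           IS.α (𝒮₀ H) (f ⟨$⟩ proj₁ x) (g ⟨$⟩ proj₁ (proj₂ x))
    over x = pres (proj₂ (proj₂ x))

    ς-over : ∀ x → Setoid._≈_ V (ς ⟨$⟩ proj₁ (over x)) (f ⟨$⟩ proj₁ x)
    ς-over x = proj₁ (proj₂ (over x))

    ω-over : ∀ x → Setoid._≈_ E (ω ⟨$⟩ proj₁ (over x)) (g ⟨$⟩ proj₁ (proj₂ x))
    ω-over x = proj₂ (proj₂ (over x))

simplification-unit : ∀ G → HypHom G (𝒩₀ (𝒮₀ G))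
simplification-unit G = 𝒩-transpose (Category.id IStr)

simplification-unit⁻¹ : ∀ {H} → Simple H → HypHom (𝒩₀ (𝒮₀ H)) H
simplification-unit⁻¹ simple = simple-transpose simple (Category.id IStr)

IStr≃ℛsimple : Equivalence IStr ℛsimple
IStr≃ℛsimple = record
  { F = corestrict 𝒩ℛ 𝒩-simple
  ; G = restrict 𝒮ℛ
  ; unit = record
      { η = ε⁻¹
      ; η⁻¹ = ε
      ; natural = λ _ → ISHom≈-pres-irrelevant
      ; isoˡ = λ _ → ISHom≈-pres-irrelevant
      ; isoʳ = λ _ → ISHom≈-pres-irrelevant
      }
  ; counit = record
      { η = λ (_ , simple) → simplification-unit⁻¹ simple
      ; η⁻¹ = λ (H , _) → simplification-unit H
      ; natural = λ {_} {H} _ → 𝒮-faithful (proj₂ H) ISHom≈-pres-irrelevant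
      ; isoˡ = λ (H , _) → 𝒮-faithful (𝒩-simple (𝒮₀ H)) ISHom≈-pres-irrelevant
      ; isoʳ = λ (_ , simple) → 𝒮-faithful simple ISHom≈-pres-irrelevant
      }
  }

simple-reflective : Reflective ℛ Simple
simple-reflective G =
  𝒩₀ (𝒮₀ G) , 𝒩-simple (𝒮₀ G) , simplification-unit G ,
  λ H simple φ → simple-transpose simple (𝒮₁ φ)
               , 𝒮-faithful simple ISHom≈-pres-irrelevant
               , λ ψ ψη≈φ → 𝒮-faithful simple
                   record { ≈f = HypHom≈.≈V ψη≈φ ; ≈g = HypHom≈.≈E ψη≈φ }

module SetoidDiagram {J : Category 0ℓ 0ℓ 0ℓ} (S : Category.Obj J → Setoid 0ℓ 0ℓ)
                     (act : ∀ {i j} → Category._⇒_ J i j → Func (S i) (S j))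
                     (act-identity : ∀ {j} x → Setoid._≈_ (S j) (act (Category.id J) ⟨$⟩ x) x)
                     where
  open Category J using (Obj; _⇒_)

  compatibleFamilies : Setoid 0ℓ 0ℓ
  compatibleFamilies = record
    { Carrier = Σ[ x ∈ (∀ j → Setoid.Carrier (S j)) ]
                  (∀ {i j} (f : i ⇒ j) → Setoid._≈_ (S j) (act f ⟨$⟩ x i) (x j))
    ; _≈_ = λ x y → ∀ j → Setoid._≈_ (S j) (proj₁ x j) (proj₁ y j)
    ; isEquivalence = record
        { refl = λ j → refl (S j)
        ; sym = λ x≈y j → sym (S j) (x≈y j)
        ; trans = λ x≈y y≈z j → trans (S j) (x≈y j) (y≈z j)
        }
    }

  project : ∀ j → Func compatibleFamilies (S j)
  project j = record { to = λ x → proj₁ x j ; cong = λ x≈y → x≈y j }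

  tuple : (T : Setoid 0ℓ 0ℓ) (τ : ∀ j → Func T (S j)) →
          (∀ {i j} (f : i ⇒ j) t → Setoid._≈_ (S j) (act f ⟨$⟩ (τ i ⟨$⟩ t)) (τ j ⟨$⟩ t)) →
          Func T compatibleFamilies
  tuple T τ compatible = record
    { to = λ t → (λ j → τ j ⟨$⟩ t) , λ f → compatible f t
    ; cong = λ t≈u j → Func.cong (τ j) t≈u
    }

  Element : Set
  Element = Σ Obj (λ j → Setoid.Carrier (S j))

  _↝_ : Rel Element 0ℓ
  (i , x) ↝ (j , y) = Σ[ f ∈ i ⇒ j ] Setoid._≈_ (S j) (act f ⟨$⟩ x) y

  glued : Setoid 0ℓ 0ℓ
  glued = EqClosure.setoid _↝_

  inject : ∀ j → Func (S j) glued
  inject j = record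
    { to = λ x → j , x
    ; cong = λ {x} x≈y → EqClosure.return (Category.id J , trans (S j) (act-identity x) x≈y)
    }

  inject-compatible : ∀ {i j} (f : i ⇒ j) x → Setoid._≈_ glued (j , act f ⟨$⟩ x) (i , x)
  inject-compatible {j = j} f x = sym glued (EqClosure.return (f , refl (S j)))

  glue : (T : Setoid 0ℓ 0ℓ) (τ : ∀ j → Func (S j) T) →
         (∀ {i j} (f : i ⇒ j) x → Setoid._≈_ T (τ j ⟨$⟩ (act f ⟨$⟩ x)) (τ i ⟨$⟩ x)) →
         Func glued T
  glue T τ compatible = record
    { to = to
    ; cong = EqClosure.gfold (Setoid.isEquivalence T) to
        λ { {i , x} {j , y} (f , fx≈y) → trans T (sym T (compatible f x)) (Func.cong (τ j) fx≈y) }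
    }
    where
      to : Element → Setoid.Carrier T
      to (j , x) = τ j ⟨$⟩ x

module IStrDiagram {J : Category 0ℓ 0ℓ 0ℓ} (D : Functor J IStr) where
  private
    module J = Category J

  module Vertices = SetoidDiagram {J} (λ j → IS.V (F₀ D j)) (λ f → ISHom.f (F₁ D f))
                                  (λ {j} → ISHom≈.≈f (identity D {j}))
  module Edges = SetoidDiagram {J} (λ j → IS.E (F₀ D j)) (λ f → ISHom.g (F₁ D f))
                               (λ {j} → ISHom≈.≈g (identity D {j}))

  limitIS : IS
  limitIS = record
    { V = Vertices.compatibleFamilies
    ; E = Edges.compatibleFamilies
    ; α = λ x y → ∀ j → IS.α (F₀ D j) (proj₁ x j) (proj₁ y j)
    ; α-resp = λ x≈ y≈ incident j → IS.α-resp (F₀ D j) (x≈ j) (y≈ j) (incident j)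
    }

  limitCone : Cone D
  limitCone = record
    { apex = limitIS
    ; ψ = λ j → record { f = Vertices.project j ; g = Edges.project j ; pres = λ incident → incident j }
    ; commute = λ f → record { ≈f = λ x → proj₂ x f ; ≈g = λ y → proj₂ y f }
    }

  limitCone-isLimit : IsLimit D limitCone
  limitCone-isLimit K =
    u , (λ j → record { ≈f = λ _ → refl (IS.V (F₀ D j)) ; ≈g = λ _ → refl (IS.E (F₀ D j)) })
      , λ _ u′-factors → record { ≈f = λ v j → ISHom≈.≈f (u′-factors j) v
                                ; ≈g = λ e j → ISHom≈.≈g (u′-factors j) e }
    where
      open Cone K
      u : ISHom apex limitIS
      u = record
        { f = Vertices.tuple (IS.V apex) (λ j → ISHom.f (ψ j)) (λ f → ISHom≈.≈f (commute f))
        ; g = Edges.tuple (IS.E apex) (λ j → ISHom.g (ψ j)) (λ f → ISHom≈.≈g (commute f))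
        ; pres = λ incident j → ISHom.pres (ψ j) incident
        }

  colimitIS : IS
  colimitIS = record
    { V = V
    ; E = E
    ; α = λ v e → Σ[ j ∈ J.Obj ] Σ[ x ∈ Setoid.Carrier (IS.V (F₀ D j)) ] Σ[ y ∈ Setoid.Carrier (IS.E (F₀ D j)) ]
                    (IS.α (F₀ D j) x y × Setoid._≈_ V v (j , x) × Setoid._≈_ E e (j , y))
    ; α-resp = λ v≈ e≈ (j , x , y , incident , v≈x , e≈y) →
        j , x , y , incident , trans V (sym V v≈) v≈x , trans E (sym E e≈) e≈y
    }
    where
      V = Vertices.glued
      E = Edges.glued

  colimitCocone : Cocone D
  colimitCocone = record
    { coapex = colimitIS
    ; ψ = λ j → record
        { f = Vertices.inject j
        ; g = Edges.inject j
        ; pres = λ {x} {y} incident → j , x , y , incident , refl Vertices.glued , refl Edges.glued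
        }
    ; commute = λ f → record { ≈f = Vertices.inject-compatible f ; ≈g = Edges.inject-compatible f }
    }

  colimitCocone-isColimit : IsColimit D colimitCocone
  colimitCocone-isColimit K =
    u , (λ _ → record { ≈f = λ _ → refl V ; ≈g = λ _ → refl E })
      , λ _ u′-factors → record { ≈f = λ (j , x) → ISHom≈.≈f (u′-factors j) x
                                ; ≈g = λ (j , y) → ISHom≈.≈g (u′-factors j) y }
    where
      open Cocone K
      V = IS.V coapex
      E = IS.E coapex
      uV : Func Vertices.glued V
      uV = Vertices.glue V (λ j → ISHom.f (ψ j)) (λ f → ISHom≈.≈f (commute f))
      uE : Func Edges.glued E
      uE = Edges.glue E (λ j → ISHom.g (ψ j)) (λ f → ISHom≈.≈g (commute f))
      u : ISHom colimitIS coapex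
      u = record
        { f = uV
        ; g = uE
        ; pres = λ (j , _ , _ , incident , v≈x , e≈y) →
            IS.α-resp coapex (sym V (Func.cong uV v≈x)) (sym E (Func.cong uE e≈y)) (ISHom.pres (ψ j) incident)
        }

IStr-complete : Complete IStr
IStr-complete J D = limitCone , limitCone-isLimit
  where open IStrDiagram D

IStr-cocomplete : Cocomplete IStr
IStr-cocomplete J D = colimitCocone , colimitCocone-isColimit
  where open IStrDiagram D

module _ {o m e o′ m′ e′ o″ m″ e″} {J : Category o m e} {C : Category o′ m′ e′}
         {C′ : Category o″ m″ e″} {D : Functor J C} (F : Functor C C′) where
  open Category C′ using (equiv)
  private module ≈ {A B} = IsEquivalence (equiv {A} {B})

  mapCone : Cone D → Cone (F ∘F D)
  mapCone K = record
    { apex = F₀ F (Cone.apex K)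
    ; ψ = λ j → F₁ F (Cone.ψ K j)
    ; commute = λ f → ≈.trans (≈.sym (homomorphism F)) (F-resp-≈ F (Cone.commute K f))
    }

  mapCocone : Cocone D → Cocone (F ∘F D)
  mapCocone K = record
    { coapex = F₀ F (Cocone.coapex K)
    ; ψ = λ j → F₁ F (Cocone.ψ K j)
    ; commute = λ f → ≈.trans (≈.sym (homomorphism F)) (F-resp-≈ F (Cocone.commute K f))
    }

point : Hyp
point = record
  { V = ≡-setoid
  ; E = ≡-setoid
  ; I = ≡-setoid
  ; ς = Identity.function ≡-setoid
  ; ω = Identity.function ≡-setoid
  }

pick : ∀ H → Setoid.Carrier (Hyp.I H) → HypHom point H
pick H i = record
  { fV = Constant.function ≡-setoid V (ς ⟨$⟩ i)
  ; fE = Constant.function ≡-setoid E (ω ⟨$⟩ i)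
  ; fI = Constant.function ≡-setoid I i
  ; ς-comm = λ _ → refl V
  ; ω-comm = λ _ → refl E
  }
  where open Hyp H

limit-simple : ∀ {o m e} {J : Category o m e} {D : Functor J ℛ} → (∀ j → Simple (F₀ D j)) →
               (L : Cone D) → IsLimit D L → Simple (Cone.apex L)
limit-simple simple L isLimit i i′ ς≈ ω≈ =
  HypHom≈.≈I (limit-arrows-unique L isLimit (pick (Cone.apex L) i) (pick (Cone.apex L) i′) same-projections) tt
  where
    same-projections : ∀ j → Category._≈_ ℛ (Category._∘_ ℛ (Cone.ψ L j) (pick _ i))
                                            (Category._∘_ ℛ (Cone.ψ L j) (pick _ i′))
    same-projections j = 𝒮-faithful (simple j) record
      { ≈f = λ _ → Func.cong (HypHom.fV (Cone.ψ L j)) ς≈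
      ; ≈g = λ _ → Func.cong (HypHom.fE (Cone.ψ L j)) ω≈
      }

module _ {J : Category 0ℓ 0ℓ 0ℓ} (D : Functor J IStr) where

  𝒮-preserves-limit : (L : Cone (𝒩ℛ ∘F D)) → IsLimit (𝒩ℛ ∘F D) L → IsLimit D (𝒮-cone D L)
  𝒮-preserves-limit L isLimit K =
    Category._∘_ IStr (𝒮₁ u) (ε⁻¹ (Cone.apex K))
    , (λ j → record { ≈f = HypHom≈.≈V (u-factors j) ; ≈g = HypHom≈.≈E (u-factors j) })
    , λ u′ u′-factors →
        let u′-transpose-unique = u-unique (simple-transpose L-simple u′) λ j →
              𝒮-faithful (𝒩-simple (F₀ D j))
                record { ≈f = ISHom≈.≈f (u′-factors j) ; ≈g = ISHom≈.≈g (u′-factors j) }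
        in record { ≈f = HypHom≈.≈V u′-transpose-unique ; ≈g = HypHom≈.≈E u′-transpose-unique }
    where
      L-simple : Simple (Cone.apex L)
      L-simple = limit-simple (λ j → 𝒩-simple (F₀ D j)) L isLimit
      open Σ (isLimit (mapCone 𝒩ℛ K)) renaming (proj₁ to u; proj₂ to u-universal)
      open Σ u-universal renaming (proj₁ to u-factors; proj₂ to u-unique)

  𝒮-preserves-colimit : (L : Cocone (𝒩ℛ ∘F D)) → IsColimit (𝒩ℛ ∘F D) L → IsColimit D (𝒮-cocone D L)
  𝒮-preserves-colimit L isColimit K =
    Category._∘_ IStr (ε (Cocone.coapex K)) (𝒮₁ u)
    , (λ j → record { ≈f = HypHom≈.≈V (u-factors j) ; ≈g = HypHom≈.≈E (u-factors j) })
    , λ u′ u′-factors →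
        let u′-transpose-unique = u-unique (𝒩-transpose u′) λ _ →
              𝒮-faithful (𝒩-simple (Cocone.coapex K))
                record { ≈f = ISHom≈.≈f (u′-factors _) ; ≈g = ISHom≈.≈g (u′-factors _) }
        in record { ≈f = HypHom≈.≈V u′-transpose-unique ; ≈g = HypHom≈.≈E u′-transpose-unique }
    where
      open Σ (isColimit (mapCocone 𝒩ℛ K)) renaming (proj₁ to u; proj₂ to u-universal)
      open Σ u-universal renaming (proj₁ to u-factors; proj₂ to u-unique)

mainTheorem10 :
    Equivalence IStr ℛsimple
    × Reflective ℛ Simple
    × Complete IStr
    × Cocomplete IStr
    × (∀ (J : Category 0ℓ 0ℓ 0ℓ) (D : Functor J IStr) (L : Cone (𝒩ℛ ∘F D)) →
         IsLimit (𝒩ℛ ∘F D) L → IsLimit D (𝒮-cone D L))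
    × (∀ (J : Category 0ℓ 0ℓ 0ℓ) (D : Functor J IStr) (L : Cocone (𝒩ℛ ∘F D)) →
         IsColimit (𝒩ℛ ∘F D) L → IsColimit D (𝒮-cocone D L))
mainTheorem10 =
  IStr≃ℛsimple , simple-reflective , IStr-complete , IStr-cocomplete
  , (λ _ → 𝒮-preserves-limit) , (λ _ → 𝒮-preserves-colimit)
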